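{- Suppose that $\mathbb{C}$ is infinitary extensive and has smooth monomorphisms, and that $\Sigma\colon\mathbb{C}\to\mathbb{C}$ preserves strong epimorphisms, monomorphisms, and directed colimits. If $\mathcal{R}$ is a set of reflexive congruences on a $\Sigma$-algebra $(A,a)$, then $\bigl(\bigvee_{R\in\mathcal{R}}R\bigr)^\star$ is a congruence on $(A,a)$, where $T^\star$ denotes the least reflexive and transitive relation containing $T$.
   Context: Standing assumptions: $\mathbb{C}$ is complete, has finite coproducts, is well-powered, monomorphisms are stable under finite coproducts, and strong epimorphisms are stable under pullback; every morphism has a (strong epi, mono)-factorization, whose mono part is its image. A relation on $X$ is a subobject $\langle l_R,r_R\rangle\colon R\rightarrowtail X\times X$; relations on $X$ form a complete lattice under $\le$ with joins $\bigvee$. $\Delta=\langle\mathrm{id},\mathrm{id}\rangle$; for $f\colon X\to Y$, $f_\star[R]$ is the image of $(f\times f)\circ\langle l_R,r_R\rangle$; the composite $R\cdot S$ is the image of $\langle l_R\circ\bar l,r_S\circ\bar r\rangle$ with $(\bar l,\bar r)$ the pullback of $r_R$ and $l_S$; $R$ is reflexive if $\Delta\le R$, transitive if $R\cdot R\le R$. The canonical lifting $\overline\Sigma R$ is the image of $\langle\Sigma l_R,\Sigma r_R\rangle$. A congruence on $(A,a)$ is a relation $R$ with $a_\star[\overline\Sigma R]\le R$. Infinitary extensive: small coproducts exist and for every set-indexed family $(X_i)$ the functor $\prod_i\mathbb{C}/X_i\to\mathbb{C}/\coprod_iX_i$, $(p_i)\mapsto\coprod_ip_i$, is an equivalence. Smooth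 monomorphisms: the join of a directed family of subobjects is the colimit of the corresponding directed diagram. -}

module Defs where

open import Level using (Level; _⊔_; Lift; lower) renaming (suc to lsuc)
open import Data.Product using (Σ; _×_; _,_; proj₁; proj₂)
open import Data.Nat using (ℕ)
open import Data.Fin using (Fin)
open import Relation.Binary using (IsEquivalence)

record Category (o ℓ e : Level) : Set (lsuc (o ⊔ ℓ ⊔ e)) where
  infixr 9 _∘_
  infix 15 _⇒_
  infix 4 _≈_
  field
    Obj : Set o
    _⇒_ : Obj → Obj → Set ℓ
    _≈_ : ∀ {A B} → A ⇒ B → A ⇒ B → Set e
    id : ∀ {A} → A ⇒ A
    _∘_ : ∀ {A B C} → B ⇒ C → A ⇒ B → A ⇒ C
    ≈-equiv : ∀ {A B} → IsEquivalence (_≈_ {A} {B})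
    ∘-resp-≈ : ∀ {A B C} {f g : B ⇒ C} {h i : A ⇒ B} → f ≈ g → h ≈ i → f ∘ h ≈ g ∘ i
    assoc : ∀ {A B C D} {f : A ⇒ B} {g : B ⇒ C} {h : C ⇒ D} → (h ∘ g) ∘ f ≈ h ∘ (g ∘ f)
    identityˡ : ∀ {A B} {f : A ⇒ B} → id ∘ f ≈ f
    identityʳ : ∀ {A B} {f : A ⇒ B} → f ∘ id ≈ f

record Endofunctor {o ℓ e} (C : Category o ℓ e) : Set (o ⊔ ℓ ⊔ e) where
  open Category C
  field
    F₀ : Obj → Obj
    F₁ : ∀ {A B} → A ⇒ B → F₀ A ⇒ F₀ B
    F-resp-≈ : ∀ {A B} {f g : A ⇒ B} → f ≈ g → F₁ f ≈ F₁ g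
    F-identity : ∀ {A} → F₁ (id {A}) ≈ id
    F-homomorphism : ∀ {A B C} {f : A ⇒ B} {g : B ⇒ C} → F₁ (g ∘ f) ≈ F₁ g ∘ F₁ f

module Notions {o ℓ e} (C : Category o ℓ e) where
  open Category C

  Mono : ∀ {A B} → A ⇒ B → Set (o ⊔ ℓ ⊔ e)
  Mono {A} f = ∀ {Z} (g h : Z ⇒ A) → f ∘ g ≈ f ∘ h → g ≈ h

  Epi : ∀ {A B} → A ⇒ B → Set (o ⊔ ℓ ⊔ e)
  Epi {B = B} f = ∀ {Z} (g h : B ⇒ Z) → g ∘ f ≈ h ∘ f → g ≈ h

  Iso : ∀ {A B} → A ⇒ B → Set (ℓ ⊔ e)
  Iso {A} {B} f = Σ (B ⇒ A) λ g → (g ∘ f ≈ id) × (f ∘ g ≈ id)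

  StrongEpi : ∀ {A B} → A ⇒ B → Set (o ⊔ ℓ ⊔ e)
  StrongEpi {A} {B} f =
    Epi f ×
    (∀ {X Y} (u : A ⇒ X) (v : B ⇒ Y) (m : X ⇒ Y) → Mono m → m ∘ u ≈ v ∘ f →
       Σ (B ⇒ X) λ d → (d ∘ f ≈ u) × (m ∘ d ≈ v))

  _≤ₘ_ : ∀ {A B X} → A ⇒ X → B ⇒ X → Set (ℓ ⊔ e)
  _≤ₘ_ {A} {B} f g = Σ (A ⇒ B) λ k → g ∘ k ≈ f

  record Product (A B : Obj) : Set (o ⊔ ℓ ⊔ e) where
    field
      A×B : Obj
      π₁ : A×B ⇒ A
      π₂ : A×B ⇒ B
      ⟨_,_⟩ : ∀ {Z} → Z ⇒ A → Z ⇒ B → Z ⇒ A×B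
      project₁ : ∀ {Z} {f : Z ⇒ A} {g : Z ⇒ B} → π₁ ∘ ⟨ f , g ⟩ ≈ f
      project₂ : ∀ {Z} {f : Z ⇒ A} {g : Z ⇒ B} → π₂ ∘ ⟨ f , g ⟩ ≈ g
      unique : ∀ {Z} {f : Z ⇒ A} {g : Z ⇒ B} (h : Z ⇒ A×B) →
               π₁ ∘ h ≈ f → π₂ ∘ h ≈ g → h ≈ ⟨ f , g ⟩

  record IndexedProduct (I : Set ℓ) (X : I → Obj) : Set (o ⊔ ℓ ⊔ e) where
    field
      ΠX : Obj
      π : ∀ i → ΠX ⇒ X i
      tuple : ∀ {Z} → (∀ i → Z ⇒ X i) → Z ⇒ ΠX
      project : ∀ {Z} (f : ∀ i → Z ⇒ X i) i → π i ∘ tuple f ≈ f i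
      unique : ∀ {Z} (f : ∀ i → Z ⇒ X i) (h : Z ⇒ ΠX) →
               (∀ i → π i ∘ h ≈ f i) → h ≈ tuple f

  record IndexedCoproduct (I : Set ℓ) (X : I → Obj) : Set (o ⊔ ℓ ⊔ e) where
    field
      ∐X : Obj
      ι : ∀ i → X i ⇒ ∐X
      copair : ∀ {Z} → (∀ i → X i ⇒ Z) → ∐X ⇒ Z
      inject : ∀ {Z} (f : ∀ i → X i ⇒ Z) i → copair f ∘ ι i ≈ f i
      unique : ∀ {Z} (f : ∀ i → X i ⇒ Z) (h : ∐X ⇒ Z) →
               (∀ i → h ∘ ι i ≈ f i) → h ≈ copair f

  ∐⟨_,_⟩ : ∀ {I : Set ℓ} {Y X : I → Obj} →
           (CY : IndexedCoproduct I Y) → (CX : IndexedCoproduct I X) →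
           (∀ i → Y i ⇒ X i) →
           IndexedCoproduct.∐X CY ⇒ IndexedCoproduct.∐X CX
  ∐⟨ CY , CX ⟩ p = IndexedCoproduct.copair CY (λ i → IndexedCoproduct.ι CX i ∘ p i)

  record Equalizer {A B} (f g : A ⇒ B) : Set (o ⊔ ℓ ⊔ e) where
    field
      E : Obj
      arr : E ⇒ A
      equality : f ∘ arr ≈ g ∘ arr
      equalize : ∀ {Z} (h : Z ⇒ A) → f ∘ h ≈ g ∘ h → Z ⇒ E
      universal : ∀ {Z} (h : Z ⇒ A) (eq : f ∘ h ≈ g ∘ h) → arr ∘ equalize h eq ≈ h
      unique : ∀ {Z} (h : Z ⇒ A) (eq : f ∘ h ≈ g ∘ h) (k : Z ⇒ E) →
               arr ∘ k ≈ h → k ≈ equalize h eq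

  record IsPullback {P A B Z} (f : A ⇒ Z) (g : B ⇒ Z) (p₁ : P ⇒ A) (p₂ : P ⇒ B)
         : Set (o ⊔ ℓ ⊔ e) where
    field
      commute : f ∘ p₁ ≈ g ∘ p₂
      universal : ∀ {Q} (h₁ : Q ⇒ A) (h₂ : Q ⇒ B) → f ∘ h₁ ≈ g ∘ h₂ →
                  Σ (Q ⇒ P) λ k → (p₁ ∘ k ≈ h₁) × (p₂ ∘ k ≈ h₂)
      unique : ∀ {Q} (k k' : Q ⇒ P) → p₁ ∘ k ≈ p₁ ∘ k' → p₂ ∘ k ≈ p₂ ∘ k' → k ≈ k'

  record Pullback {A B Z} (f : A ⇒ Z) (g : B ⇒ Z) : Set (o ⊔ ℓ ⊔ e) where
    field
      P : Obj
      p₁ : P ⇒ A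
      p₂ : P ⇒ B
      isPullback : IsPullback f g p₁ p₂

  record Factorization {A B} (f : A ⇒ B) : Set (o ⊔ ℓ ⊔ e) where
    field
      mid : Obj
      m : mid ⇒ B
      q : A ⇒ mid
      m-mono : Mono m
      q-strongEpi : StrongEpi q
      factors : m ∘ q ≈ f

  record WellPowered : Set (lsuc ℓ ⊔ o ⊔ ℓ ⊔ e) where
    field
      Sub : Obj → Set ℓ
      subObj : ∀ {X} → Sub X → Obj
      subArr : ∀ {X} (s : Sub X) → subObj s ⇒ X
      subMono : ∀ {X} (s : Sub X) → Mono (subArr s)
      represent : ∀ {A X} (m : A ⇒ X) → Mono m →
                  Σ (Sub X) λ s → Σ (A ⇒ subObj s) λ φ → Iso φ × (subArr s ∘ φ ≈ m)

  record IsColimit {I : Set ℓ} {e'} (D : I → Obj) (Arr : I → I → Set e')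
         (d : ∀ {i j} → Arr i j → D i ⇒ D j) (L : Obj) (c : ∀ i → D i ⇒ L)
         : Set (o ⊔ ℓ ⊔ e ⊔ e') where
    field
      cocone : ∀ {i j} (p : Arr i j) → c j ∘ d p ≈ c i
      universal : ∀ {Z} (z : ∀ i → D i ⇒ Z) → (∀ {i j} (p : Arr i j) → z j ∘ d p ≈ z i) →
                  Σ (L ⇒ Z) λ h → ∀ i → h ∘ c i ≈ z i
      unique : ∀ {Z} (h h' : L ⇒ Z) → (∀ i → h ∘ c i ≈ h' ∘ c i) → h ≈ h'

  record DirectedDiagram : Set (lsuc ℓ ⊔ o ⊔ ℓ ⊔ e) where
    field
      I : Set ℓ
      _≤_ : I → I → Set ℓ
      ≤-refl : ∀ {i} → i ≤ i
      ≤-trans : ∀ {i j k} → i ≤ j → j ≤ k → i ≤ k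
      inhabited : I
      upper : ∀ i j → Σ I λ k → (i ≤ k) × (j ≤ k)
      D : I → Obj
      d : ∀ {i j} → i ≤ j → D i ⇒ D j
      d-irrelevant : ∀ {i j} (p q : i ≤ j) → d p ≈ d q
      d-identity : ∀ {i} → d (≤-refl {i}) ≈ id
      d-homomorphism : ∀ {i j k} (p : i ≤ j) (q : j ≤ k) → d (≤-trans p q) ≈ d q ∘ d p

  -- C is infinitary extensive: small coproducts exist and
  -- ∏ᵢ C/Xᵢ → C/∐Xᵢ , (pᵢ) ↦ ∐pᵢ  is an equivalence
  -- (rendered as: faithful, full and essentially surjective).
  record InfinitaryExtensive : Set (lsuc ℓ ⊔ o ⊔ ℓ ⊔ e) where
    field
      coproduct : ∀ (I : Set ℓ) (X : I → Obj) → IndexedCoproduct I X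
    ∐ : ∀ {I : Set ℓ} {Y X : I → Obj} (p : ∀ i → Y i ⇒ X i) →
        IndexedCoproduct.∐X (coproduct I Y) ⇒ IndexedCoproduct.∐X (coproduct I X)
    ∐ {I} {Y} {X} p = ∐⟨ coproduct I Y , coproduct I X ⟩ p
    field
      faithful : ∀ {I : Set ℓ} {X Y Y' : I → Obj}
                 (p : ∀ i → Y i ⇒ X i) (p' : ∀ i → Y' i ⇒ X i)
                 (f g : ∀ i → Y i ⇒ Y' i) →
                 (∀ i → p' i ∘ f i ≈ p i) → (∀ i → p' i ∘ g i ≈ p i) →
                 ∐ f ≈ ∐ g → ∀ i → f i ≈ g i
      full : ∀ {I : Set ℓ} {X Y Y' : I → Obj}
             (p : ∀ i → Y i ⇒ X i) (p' : ∀ i → Y' i ⇒ X i)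
             (h : IndexedCoproduct.∐X (coproduct I Y) ⇒ IndexedCoproduct.∐X (coproduct I Y')) →
             ∐ p' ∘ h ≈ ∐ p →
             Σ (∀ i → Y i ⇒ Y' i) λ f → (∀ i → p' i ∘ f i ≈ p i) × (∐ f ≈ h)
      essSurj : ∀ {I : Set ℓ} {X : I → Obj} {Z} (q : Z ⇒ IndexedCoproduct.∐X (coproduct I X)) →
                Σ (I → Obj) λ Y → Σ (∀ i → Y i ⇒ X i) λ p →
                Σ (IndexedCoproduct.∐X (coproduct I Y) ⇒ Z) λ φ → Iso φ × (q ∘ φ ≈ ∐ p)

  -- C has smooth monomorphisms: for a directed family of subobjects (mᵢ)
  -- of X with join j (and inclusions uᵢ), the uᵢ form a colimit of the
  -- diagram of the Sᵢ and the inclusions between them.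
  SmoothMonos : Set (lsuc ℓ ⊔ o ⊔ ℓ ⊔ e)
  SmoothMonos =
    ∀ {X} {I : Set ℓ} (S : I → Obj) (m : ∀ i → S i ⇒ X) → (∀ i → Mono (m i)) →
    I → (∀ i k → Σ I λ l → (m i ≤ₘ m l) × (m k ≤ₘ m l)) →
    ∀ {J} (j : J ⇒ X) → Mono j → (u : ∀ i → S i ⇒ J) → (∀ i → j ∘ u i ≈ m i) →
    (∀ {Z} (z : Z ⇒ X) → Mono z → (∀ i → m i ≤ₘ z) → j ≤ₘ z) →
    IsColimit S (λ i k → Σ (S i ⇒ S k) λ t → m k ∘ t ≈ m i) proj₁ J u

  -- Completeness is rendered as: all small
  -- products and all equalizers (plus, redundantly, chosen pullbacks and
  -- binary products); finite coproducts are coproducts indexed by Fin n.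
  record Standing : Set (lsuc ℓ ⊔ o ⊔ ℓ ⊔ e) where
    field
      product : ∀ A B → Product A B
      indexedProduct : ∀ (I : Set ℓ) (X : I → Obj) → IndexedProduct I X
      equalizer : ∀ {A B} (f g : A ⇒ B) → Equalizer f g
      pullback : ∀ {A B Z} (f : A ⇒ Z) (g : B ⇒ Z) → Pullback f g
      finCoproduct : ∀ n (X : Fin n → Obj) → IndexedCoproduct (Lift ℓ (Fin n)) (λ i → X (lower i))
      wellPowered : WellPowered
      mono-coproduct : ∀ n (A B : Fin n → Obj) (m : ∀ i → A i ⇒ B i) → (∀ i → Mono (m i)) →
                       Mono (∐⟨ finCoproduct n A , finCoproduct n B ⟩ (λ i → m (lower i)))
      strongEpi-pullback : ∀ {P A B Z} {f : A ⇒ Z} {g : B ⇒ Z} {p₁ : P ⇒ A} {p₂ : P ⇒ B} →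
                           IsPullback f g p₁ p₂ → StrongEpi g → StrongEpi p₁
      factor : ∀ {A B} (f : A ⇒ B) → Factorization f

  module _ (F : Endofunctor C) where
    open Endofunctor F

    PreservesStrongEpi : Set (o ⊔ ℓ ⊔ e)
    PreservesStrongEpi = ∀ {A B} (f : A ⇒ B) → StrongEpi f → StrongEpi (F₁ f)

    PreservesMono : Set (o ⊔ ℓ ⊔ e)
    PreservesMono = ∀ {A B} (f : A ⇒ B) → Mono f → Mono (F₁ f)

    PreservesDirectedColimits : Set (lsuc ℓ ⊔ o ⊔ ℓ ⊔ e)
    PreservesDirectedColimits =
      ∀ (𝔻 : DirectedDiagram) (L : Obj) (c : ∀ i → DirectedDiagram.D 𝔻 i ⇒ L) →
      IsColimit (DirectedDiagram.D 𝔻) (DirectedDiagram._≤_ 𝔻) (DirectedDiagram.d 𝔻) L c →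
      IsColimit (λ i → F₀ (DirectedDiagram.D 𝔻 i)) (DirectedDiagram._≤_ 𝔻)
                (λ p → F₁ (DirectedDiagram.d 𝔻 p)) (F₀ L) (λ i → F₁ (c i))

module Relations {o ℓ e} (C : Category o ℓ e) (St : Notions.Standing C) where
  open Category C
  open Notions C
  open Standing St

  infixr 25 _×₀_
  _×₀_ : Obj → Obj → Obj
  A ×₀ B = Product.A×B (product A B)

  ⟨_,_⟩ : ∀ {Z A B} → Z ⇒ A → Z ⇒ B → Z ⇒ A ×₀ B
  ⟨ f , g ⟩ = Product.⟨_,_⟩ (product _ _) f g

  π₁ : ∀ {A B} → A ×₀ B ⇒ A
  π₁ = Product.π₁ (product _ _)

  π₂ : ∀ {A B} → A ×₀ B ⇒ B
  π₂ = Product.π₂ (product _ _)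

  _⊗_ : ∀ {X Y} → X ⇒ Y → X ⇒ Y → X ×₀ X ⇒ Y ×₀ Y
  f ⊗ g = ⟨ f ∘ π₁ , g ∘ π₂ ⟩

  ImObj : ∀ {A B} → A ⇒ B → Obj
  ImObj f = Factorization.mid (factor f)

  Image : ∀ {A B} (f : A ⇒ B) → ImObj f ⇒ B
  Image f = Factorization.m (factor f)

  record Rel (X : Obj) : Set (o ⊔ ℓ ⊔ e) where
    field
      carrier : Obj
      arr : carrier ⇒ X ×₀ X
      arr-mono : Mono arr
    l : carrier ⇒ X
    l = π₁ ∘ arr
    r : carrier ⇒ X
    r = π₂ ∘ arr

  _≤R_ : ∀ {X} → Rel X → Rel X → Set (ℓ ⊔ e)
  R ≤R S = Rel.arr R ≤ₘ Rel.arr S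

  imageRel : ∀ {A X} → A ⇒ X ×₀ X → Rel X
  imageRel f = record { carrier = ImObj f ; arr = Image f
                      ; arr-mono = Factorization.m-mono (factor f) }

  Reflexive : ∀ {X} → Rel X → Set (ℓ ⊔ e)
  Reflexive {X} R = ⟨ id {X} , id {X} ⟩ ≤ₘ Rel.arr R

  _·_ : ∀ {X} → Rel X → Rel X → Rel X
  R · S = imageRel ⟨ Rel.l R ∘ Pullback.p₁ pb , Rel.r S ∘ Pullback.p₂ pb ⟩
    where pb = pullback (Rel.r R) (Rel.l S)

  Transitive : ∀ {X} → Rel X → Set (ℓ ⊔ e)
  Transitive R = (R · R) ≤R R

  _⋆[_] : ∀ {X Y} → X ⇒ Y → Rel X → Rel Y
  f ⋆[ R ] = imageRel ((f ⊗ f) ∘ Rel.arr R)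

  IsJoin : ∀ {X} {I : Set ℓ} → (I → Rel X) → Rel X → Set (o ⊔ ℓ ⊔ e)
  IsJoin R J = (∀ i → R i ≤R J) × (∀ S → (∀ i → R i ≤R S) → J ≤R S)

  IsRTClosure : ∀ {X} → Rel X → Rel X → Set (o ⊔ ℓ ⊔ e)
  IsRTClosure T U =
    Reflexive U × Transitive U × T ≤R U ×
    (∀ V → Reflexive V → Transitive V → T ≤R V → U ≤R V)

  module _ (F : Endofunctor C) where
    open Endofunctor F

    lift : ∀ {X} → Rel X → Rel (F₀ X)
    lift R = imageRel ⟨ F₁ (Rel.l R) , F₁ (Rel.r R) ⟩

    Congruence : ∀ {A} → F₀ A ⇒ A → Rel A → Set (ℓ ⊔ e)
    Congruence a R = (a ⋆[ lift R ]) ≤R R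

module Submission where

-- For a word w = i₁ … iₙ let path w be the composite R_{i₁} · … · R_{iₙ} and W the
-- union of the images of all paths. W contains every R_i, is reflexive (empty word)
-- and transitive (concatenation, using extensivity to split pullbacks of the cover
-- ∐ path w ↠ W), so W = (⋁ ℛ)⋆. Ordered by subwords, the images form a directed
-- family (missing letters are filled in by reflexive steps) whose colimit is W by
-- smoothness. Each image is a congruence, since a composite of congruences carries
-- an algebra structure and Σ preserves strong epis; as Σ preserves the colimit,
-- these structures glue to one on W.

open import Level using (Level; _⊔_)
open import Data.Product using (Σ; _,_; proj₁; proj₂; _×_)
open import Data.List using (List; []; _∷_; _++_)
open import Data.List.Relation.Binary.Sublist.Propositional
  using (_⊆_; []; _∷_; _∷ʳ_; ⊆-refl; ⊆-trans)
open import Data.List.Relation.Binary.Sublist.Propositional.Properties using (++⁺ˡ; ++⁺ʳ)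
open import Relation.Binary.Bundles using (Setoid)
open import Relation.Binary.Structures using (IsEquivalence)
open import Relation.Binary.PropositionalEquality using (refl)
import Relation.Binary.Reasoning.Setoid as SetoidReasoning
open import Defs

module HomReasoning {o ℓ e} (C : Category o ℓ e) where
  open Category C

  module Equiv {A B : Obj} = IsEquivalence (≈-equiv {A} {B})

  hom-setoid : Obj → Obj → Setoid ℓ e
  hom-setoid A B = record { isEquivalence = ≈-equiv {A} {B} }

  module _ {A B : Obj} where
    open SetoidReasoning (hom-setoid A B) public

  infixr 4 _⟩∘⟨_ refl⟩∘⟨_
  infixl 5 _⟩∘⟨refl

  _⟩∘⟨_ : ∀ {X Y Z} {f g : Y ⇒ Z} {h i : X ⇒ Y} → f ≈ g → h ≈ i → f ∘ h ≈ g ∘ i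
  _⟩∘⟨_ = ∘-resp-≈

  refl⟩∘⟨_ : ∀ {X Y Z} {f : Y ⇒ Z} {h i : X ⇒ Y} → h ≈ i → f ∘ h ≈ f ∘ i
  refl⟩∘⟨ p = Equiv.refl ⟩∘⟨ p

  _⟩∘⟨refl : ∀ {X Y Z} {f g : Y ⇒ Z} {h : X ⇒ Y} → f ≈ g → f ∘ h ≈ g ∘ h
  p ⟩∘⟨refl = p ⟩∘⟨ Equiv.refl

  sym-assoc : ∀ {W X Y Z} {f : W ⇒ X} {g : X ⇒ Y} {h : Y ⇒ Z} → h ∘ (g ∘ f) ≈ (h ∘ g) ∘ f
  sym-assoc = Equiv.sym assoc

  pullˡ : ∀ {W X Y Z} {a : Y ⇒ Z} {b : X ⇒ Y} {c : X ⇒ Z} {f : W ⇒ X} →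
          a ∘ b ≈ c → a ∘ (b ∘ f) ≈ c ∘ f
  pullˡ p = Equiv.trans sym-assoc (p ⟩∘⟨refl)

  pullʳ : ∀ {W X Y Z} {a : Y ⇒ Z} {b : X ⇒ Y} {c : W ⇒ X} {d : W ⇒ Y} →
          b ∘ c ≈ d → (a ∘ b) ∘ c ≈ a ∘ d
  pullʳ p = Equiv.trans assoc (refl⟩∘⟨ p)

module Factoring {o ℓ e} (C : Category o ℓ e) where
  open Category C
  open Notions C
  open HomReasoning C

  ≤ₘ-trans : ∀ {X Y Z B} {f : X ⇒ B} {g : Y ⇒ B} {h : Z ⇒ B} → f ≤ₘ g → g ≤ₘ h → f ≤ₘ h
  ≤ₘ-trans (k , gk≈f) (k' , hk'≈g) = k' ∘ k , Equiv.trans (pullˡ hk'≈g) gk≈f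

  ≤ₘ-resp-≈ : ∀ {X Y B} {f f' : X ⇒ B} {g : Y ⇒ B} → f ≈ f' → f ≤ₘ g → f' ≤ₘ g
  ≤ₘ-resp-≈ f≈f' (k , gk≈f) = k , Equiv.trans gk≈f f≈f'

  ≤ₘ-∘ : ∀ {W X Y B} {f : X ⇒ B} {g : Y ⇒ B} (h : W ⇒ X) → f ≤ₘ g → (f ∘ h) ≤ₘ g
  ≤ₘ-∘ h (k , gk≈f) = k ∘ h , pullˡ gk≈f

  strongEpi-cancel : ∀ {X Y B M'} {s : X ⇒ Y} {h : Y ⇒ B} {M : M' ⇒ B} →
                     StrongEpi s → Mono M → (h ∘ s) ≤ₘ M → h ≤ₘ M
  strongEpi-cancel {h = h} {M} (_ , diagonal) M-mono (k , Mk≈hs) with diagonal k h M M-mono Mk≈hs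
  ... | d , _ , Md≈h = d , Md≈h

  iso-cancel : ∀ {X Y B M'} {φ : X ⇒ Y} {h : Y ⇒ B} {M : M' ⇒ B} →
               Iso φ → (h ∘ φ) ≤ₘ M → h ≤ₘ M
  iso-cancel {φ = φ} {h} {M} (φ⁻¹ , _ , φφ⁻¹≈id) (k , Mk≈hφ) = k ∘ φ⁻¹ , (begin
    M ∘ (k ∘ φ⁻¹)     ≈⟨ pullˡ Mk≈hφ ⟩
    (h ∘ φ) ∘ φ⁻¹     ≈⟨ pullʳ φφ⁻¹≈id ⟩
    h ∘ id            ≈⟨ identityʳ ⟩
    h                 ∎)

  module _ {I : Set ℓ} {X : I → Obj} (cp : IndexedCoproduct I X) where
    open IndexedCoproduct cp

    copair-ext : ∀ {Z} {f g : ∐X ⇒ Z} → (∀ i → f ∘ ι i ≈ g ∘ ι i) → f ≈ g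
    copair-ext {f = f} {g} f≈g = Equiv.trans (unique _ f (λ _ → Equiv.refl))
                                             (Equiv.sym (unique _ g (λ i → Equiv.sym (f≈g i))))

    ≤ₘ-copair : ∀ {B M'} {f : ∐X ⇒ B} {M : M' ⇒ B} → (∀ i → (f ∘ ι i) ≤ₘ M) → f ≤ₘ M
    ≤ₘ-copair pieces = copair (λ i → proj₁ (pieces i)) ,
      copair-ext λ i → Equiv.trans (pullʳ (inject _ i)) (proj₂ (pieces i))

module ProductsAndImages {o ℓ e} (C : Category o ℓ e) (St : Notions.Standing C) where
  open Category C
  open Notions C
  open Notions.Standing St
  open Relations C St
  open HomReasoning C
  open Factoring C

  π₁∘⟨⟩ : ∀ {Z X Y} {f : Z ⇒ X} {g : Z ⇒ Y} → π₁ ∘ ⟨ f , g ⟩ ≈ f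
  π₁∘⟨⟩ = Product.project₁ (product _ _)

  π₂∘⟨⟩ : ∀ {Z X Y} {f : Z ⇒ X} {g : Z ⇒ Y} → π₂ ∘ ⟨ f , g ⟩ ≈ g
  π₂∘⟨⟩ = Product.project₂ (product _ _)

  π-jointly-monic : ∀ {Z X Y} {f g : Z ⇒ X ×₀ Y} → π₁ ∘ f ≈ π₁ ∘ g → π₂ ∘ f ≈ π₂ ∘ g → f ≈ g
  π-jointly-monic {f = f} {g} π₁f≈π₁g π₂f≈π₂g =
    Equiv.trans (Product.unique (product _ _) f π₁f≈π₁g π₂f≈π₂g)
                (Equiv.sym (Product.unique (product _ _) g Equiv.refl Equiv.refl))

  ⟨⟩-cong : ∀ {Z X Y} {f f' : Z ⇒ X} {g g' : Z ⇒ Y} → f ≈ f' → g ≈ g' → ⟨ f , g ⟩ ≈ ⟨ f' , g' ⟩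
  ⟨⟩-cong f≈f' g≈g' = π-jointly-monic (Equiv.trans π₁∘⟨⟩ (Equiv.trans f≈f' (Equiv.sym π₁∘⟨⟩)))
                                      (Equiv.trans π₂∘⟨⟩ (Equiv.trans g≈g' (Equiv.sym π₂∘⟨⟩)))

  ⟨⟩∘ : ∀ {W Z X Y} {f : Z ⇒ X} {g : Z ⇒ Y} {h : W ⇒ Z} → ⟨ f , g ⟩ ∘ h ≈ ⟨ f ∘ h , g ∘ h ⟩
  ⟨⟩∘ = π-jointly-monic (Equiv.trans (pullˡ π₁∘⟨⟩) (Equiv.sym π₁∘⟨⟩))
                        (Equiv.trans (pullˡ π₂∘⟨⟩) (Equiv.sym π₂∘⟨⟩))

  ⟨⟩-η : ∀ {Z X Y} {f : Z ⇒ X ×₀ Y} → ⟨ π₁ ∘ f , π₂ ∘ f ⟩ ≈ f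
  ⟨⟩-η = π-jointly-monic π₁∘⟨⟩ π₂∘⟨⟩

  image-cover : ∀ {X B} (f : X ⇒ B) → X ⇒ ImObj f
  image-cover f = Factorization.q (factor f)

  image-cover-strongEpi : ∀ {X B} (f : X ⇒ B) → StrongEpi (image-cover f)
  image-cover-strongEpi f = Factorization.q-strongEpi (factor f)

  image-mono : ∀ {X B} (f : X ⇒ B) → Mono (Image f)
  image-mono f = Factorization.m-mono (factor f)

  image-factors : ∀ {X B} (f : X ⇒ B) → Image f ∘ image-cover f ≈ f
  image-factors f = Factorization.factors (factor f)

  ≤-image : ∀ {X B} (f : X ⇒ B) → f ≤ₘ Image f
  ≤-image f = image-cover f , image-factors f

  image-least : ∀ {X B M'} {f : X ⇒ B} {M : M' ⇒ B} → Mono M → f ≤ₘ M → Image f ≤ₘ M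
  image-least {f = f} M-mono f≤M =
    strongEpi-cancel (image-cover-strongEpi f) M-mono (≤ₘ-resp-≈ (Equiv.sym (image-factors f)) f≤M)

module Homomorphisms {o ℓ e} (C : Category o ℓ e) (F : Endofunctor C) where
  open Category C
  open Notions C
  open Endofunctor F
  open HomReasoning C
  open Factoring C

  IsHom : ∀ {X B} → F₀ B ⇒ B → F₀ X ⇒ X → X ⇒ B → Set e
  IsHom b x f = f ∘ x ≈ b ∘ F₁ f

  -- An algebra structure on the domain of f making f a homomorphism into (B , b);
  -- unfolded, this is exactly  (b ∘ F₁ f) ≤ₘ f , and it is used in that form.
  HomStructure : ∀ {X B} → F₀ B ⇒ B → X ⇒ B → Set (ℓ ⊔ e)
  HomStructure {X} b f = Σ (F₀ X ⇒ X) λ x → IsHom b x f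

  IsHom-resp-≈ : ∀ {X B} {b : F₀ B ⇒ B} {x : F₀ X ⇒ X} {f g : X ⇒ B} →
                 f ≈ g → IsHom b x f → IsHom b x g
  IsHom-resp-≈ {b = b} {x} {f} {g} f≈g hom = begin
    g ∘ x      ≈⟨ f≈g ⟩∘⟨refl ⟨
    f ∘ x      ≈⟨ hom ⟩
    b ∘ F₁ f   ≈⟨ refl⟩∘⟨ F-resp-≈ f≈g ⟩
    b ∘ F₁ g   ∎

  HomStructure-resp-≈ : ∀ {X B} {b : F₀ B ⇒ B} {f g : X ⇒ B} →
                        f ≈ g → HomStructure b f → HomStructure b g
  HomStructure-resp-≈ f≈g (x , hom) = x , IsHom-resp-≈ f≈g hom

  IsHom-∘ : ∀ {X B D} {d : F₀ D ⇒ D} {b : F₀ B ⇒ B} {x : F₀ X ⇒ X} {g : B ⇒ D} {f : X ⇒ B} →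
            IsHom d b g → IsHom b x f → IsHom d x (g ∘ f)
  IsHom-∘ {d = d} {b} {x} {g} {f} g-hom f-hom = begin
    (g ∘ f) ∘ x        ≈⟨ pullʳ f-hom ⟩
    g ∘ (b ∘ F₁ f)     ≈⟨ pullˡ g-hom ⟩
    (d ∘ F₁ g) ∘ F₁ f  ≈⟨ pullʳ (Equiv.sym F-homomorphism) ⟩
    d ∘ F₁ (g ∘ f)     ∎

  IsHom-∘F₁ : ∀ {X Y B} {b : F₀ B ⇒ B} {x : F₀ X ⇒ X} {f : X ⇒ B} →
              IsHom b x f → (g : Y ⇒ X) → f ∘ (x ∘ F₁ g) ≈ b ∘ F₁ (f ∘ g)
  IsHom-∘F₁ {b = b} {x} {f} hom g = begin
    f ∘ (x ∘ F₁ g)     ≈⟨ pullˡ hom ⟩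
    (b ∘ F₁ f) ∘ F₁ g  ≈⟨ pullʳ (Equiv.sym F-homomorphism) ⟩
    b ∘ F₁ (f ∘ g)     ∎

  HomStructure-transfer : ∀ {X Y B} {b : F₀ B ⇒ B} {M : X ⇒ B} {N : Y ⇒ B} →
                          HomStructure b M → N ≤ₘ M → M ≤ₘ N → HomStructure b N
  HomStructure-transfer {b = b} {M} {N} (x , hom) (k , Mk≈N) (k' , Nk'≈M) = k' ∘ (x ∘ F₁ k) , (begin
    N ∘ (k' ∘ (x ∘ F₁ k))  ≈⟨ pullˡ Nk'≈M ⟩
    M ∘ (x ∘ F₁ k)         ≈⟨ IsHom-∘F₁ hom k ⟩
    b ∘ F₁ (M ∘ k)         ≈⟨ refl⟩∘⟨ F-resp-≈ Mk≈N ⟩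
    b ∘ F₁ N               ∎)

  HomStructure-descends : PreservesStrongEpi F →
                          ∀ {X Y B} {b : F₀ B ⇒ B} {s : Y ⇒ X} {M : X ⇒ B} →
                          StrongEpi s → Mono M → HomStructure b (M ∘ s) → HomStructure b M
  HomStructure-descends F-strongEpi {b = b} {s} {M} s-strongEpi M-mono (y , hom) =
    strongEpi-cancel (F-strongEpi s s-strongEpi) M-mono (s ∘ y , (begin
      M ∘ (s ∘ y)         ≈⟨ sym-assoc ⟩
      (M ∘ s) ∘ y         ≈⟨ hom ⟩
      b ∘ F₁ (M ∘ s)      ≈⟨ refl⟩∘⟨ F-homomorphism ⟩
      b ∘ (F₁ M ∘ F₁ s)   ≈⟨ sym-assoc ⟩
      (b ∘ F₁ M) ∘ F₁ s   ∎))

  HomStructure-colimit : PreservesDirectedColimits F →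
    ∀ (𝔻 : DirectedDiagram) {L} {c : ∀ i → DirectedDiagram.D 𝔻 i ⇒ L} →
    IsColimit (DirectedDiagram.D 𝔻) (DirectedDiagram._≤_ 𝔻) (DirectedDiagram.d 𝔻) L c →
    ∀ {B} {b : F₀ B ⇒ B} {M : L ⇒ B} → Mono M →
    (∀ i → HomStructure b (M ∘ c i)) → HomStructure b M
  HomStructure-colimit F-colimits 𝔻 {L} {c} colim {b = b} {M} M-mono homs = h , M-hom
    where
      open DirectedDiagram 𝔻
      module Fcolim = IsColimit (F-colimits 𝔻 L c colim)

      x : ∀ i → F₀ (D i) ⇒ D i
      x i = proj₁ (homs i)

      z : ∀ i → F₀ (D i) ⇒ L
      z i = c i ∘ x i

      z-cocone : ∀ {i j} (p : i ≤ j) → z j ∘ F₁ (d p) ≈ z i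
      z-cocone {i} {j} p = M-mono _ _ (begin
        M ∘ (z j ∘ F₁ (d p))          ≈⟨ refl⟩∘⟨ assoc ⟩
        M ∘ (c j ∘ (x j ∘ F₁ (d p)))  ≈⟨ sym-assoc ⟩
        (M ∘ c j) ∘ (x j ∘ F₁ (d p))  ≈⟨ IsHom-∘F₁ (proj₂ (homs j)) (d p) ⟩
        b ∘ F₁ ((M ∘ c j) ∘ d p)      ≈⟨ refl⟩∘⟨ F-resp-≈ (pullʳ (IsColimit.cocone colim p)) ⟩
        b ∘ F₁ (M ∘ c i)              ≈⟨ Equiv.sym (proj₂ (homs i)) ⟩
        (M ∘ c i) ∘ x i               ≈⟨ assoc ⟩
        M ∘ z i                       ∎)

      h : F₀ L ⇒ L
      h = proj₁ (Fcolim.universal z z-cocone)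

      M-hom : M ∘ h ≈ b ∘ F₁ M
      M-hom = Fcolim.unique _ _ λ i → begin
        (M ∘ h) ∘ F₁ (c i)   ≈⟨ pullʳ (proj₂ (Fcolim.universal z z-cocone) i) ⟩
        M ∘ (c i ∘ x i)      ≈⟨ sym-assoc ⟩
        (M ∘ c i) ∘ x i      ≈⟨ proj₂ (homs i) ⟩
        b ∘ F₁ (M ∘ c i)     ≈⟨ refl⟩∘⟨ F-homomorphism ⟩
        b ∘ (F₁ M ∘ F₁ (c i)) ≈⟨ sym-assoc ⟩
        (b ∘ F₁ M) ∘ F₁ (c i) ∎

module Congruences {o ℓ e} (C : Category o ℓ e) (St : Notions.Standing C) (F : Endofunctor C)
                   {A : Category.Obj C} (a : Category._⇒_ C (Endofunctor.F₀ F A) A) where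
  open Category C
  open Notions C
  open Relations C St
  open Endofunctor F
  open HomReasoning C
  open Factoring C
  open ProductsAndImages C St
  open Homomorphisms C F

  a² : F₀ (A ×₀ A) ⇒ A ×₀ A
  a² = ⟨ a ∘ F₁ π₁ , a ∘ F₁ π₂ ⟩

  π₁-hom : IsHom a a² π₁
  π₁-hom = π₁∘⟨⟩

  π₂-hom : IsHom a a² π₂
  π₂-hom = π₂∘⟨⟩

  IsHom-from-π : ∀ {X} {x : F₀ X ⇒ X} {f : X ⇒ A ×₀ A} →
                 IsHom a x (π₁ ∘ f) → IsHom a x (π₂ ∘ f) → IsHom a² x f
  IsHom-from-π {f = f} π₁f-hom π₂f-hom = π-jointly-monic
    (Equiv.trans sym-assoc (Equiv.trans π₁f-hom (Equiv.sym (IsHom-∘F₁ π₁-hom f))))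
    (Equiv.trans sym-assoc (Equiv.trans π₂f-hom (Equiv.sym (IsHom-∘F₁ π₂-hom f))))

  IsHom-⟨⟩ : ∀ {X} {x : F₀ X ⇒ X} {l r : X ⇒ A} → IsHom a x l → IsHom a x r → IsHom a² x ⟨ l , r ⟩
  IsHom-⟨⟩ l-hom r-hom = IsHom-from-π (IsHom-resp-≈ (Equiv.sym π₁∘⟨⟩) l-hom)
                                      (IsHom-resp-≈ (Equiv.sym π₂∘⟨⟩) r-hom)

  lift-square : ∀ {X} (f : X ⇒ A ×₀ A) → (a ⊗ a) ∘ ⟨ F₁ (π₁ ∘ f) , F₁ (π₂ ∘ f) ⟩ ≈ a² ∘ F₁ f
  lift-square f = π-jointly-monic
    (Equiv.trans (pullˡ π₁∘⟨⟩) (Equiv.trans (pullʳ π₁∘⟨⟩) (Equiv.sym (IsHom-∘F₁ π₁-hom f))))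
    (Equiv.trans (pullˡ π₂∘⟨⟩) (Equiv.trans (pullʳ π₂∘⟨⟩) (Equiv.sym (IsHom-∘F₁ π₂-hom f))))

  module _ (R : Rel A) where
    private
      L : F₀ (Rel.carrier R) ⇒ F₀ A ×₀ F₀ A
      L = ⟨ F₁ (Rel.l R) , F₁ (Rel.r R) ⟩

      lift-cover : ((a ⊗ a) ∘ Image L) ∘ image-cover L ≈ a² ∘ F₁ (Rel.arr R)
      lift-cover = Equiv.trans (pullʳ (image-factors L)) (lift-square (Rel.arr R))

    congruence⇒HomStructure : Congruence F a R → HomStructure a² (Rel.arr R)
    congruence⇒HomStructure cong =
      ≤ₘ-resp-≈ lift-cover (≤ₘ-∘ (image-cover L) (≤ₘ-trans (≤-image _) cong))

    HomStructure⇒congruence : HomStructure a² (Rel.arr R) → Congruence F a R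
    HomStructure⇒congruence hom = image-least (Rel.arr-mono R)
      (strongEpi-cancel (image-cover-strongEpi L) (Rel.arr-mono R)
        (≤ₘ-resp-≈ (Equiv.sym lift-cover) hom))

  congruence-transfer : ∀ {R S : Rel A} → Congruence F a R → R ≤R S → S ≤R R → Congruence F a S
  congruence-transfer {R} {S} R-cong R≤S S≤R = HomStructure⇒congruence S
    (HomStructure-transfer (congruence⇒HomStructure R R-cong) S≤R R≤S)

module Spans {o ℓ e} (C : Category o ℓ e) (St : Notions.Standing C) (A : Category.Obj C) where
  open Category C
  open Notions C
  open Notions.Standing St
  open Relations C St
  open HomReasoning C
  open Factoring C
  open ProductsAndImages C St

  record Span : Set (o ⊔ ℓ) where
    constructor span
    field
      {apex} : Obj
      src : apex ⇒ A
      tgt : apex ⇒ A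

    pair : apex ⇒ A ×₀ A
    pair = ⟨ src , tgt ⟩

  open Span

  record _⇛_ (s t : Span) : Set (ℓ ⊔ e) where
    field
      map : apex s ⇒ apex t
      src-map : src t ∘ map ≈ src s
      tgt-map : tgt t ∘ map ≈ tgt s

  open _⇛_

  ⇛-id : ∀ {s} → s ⇛ s
  ⇛-id = record { map = id ; src-map = identityʳ ; tgt-map = identityʳ }

  ⇛-trans : ∀ {s t u} → s ⇛ t → t ⇛ u → s ⇛ u
  ⇛-trans f g = record
    { map = map g ∘ map f
    ; src-map = Equiv.trans (pullˡ (src-map g)) (src-map f)
    ; tgt-map = Equiv.trans (pullˡ (tgt-map g)) (tgt-map f)
    }

  ⇛⇒≤ₘ : ∀ {s t} → s ⇛ t → pair s ≤ₘ pair t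
  ⇛⇒≤ₘ f = map f , Equiv.trans ⟨⟩∘ (⟨⟩-cong (src-map f) (tgt-map f))

  idSpan : Span
  idSpan = span (id {A}) id

  relSpan : Rel A → Span
  relSpan R = span (Rel.l R) (Rel.r R)

  relSpan-pair-≤ₘ : ∀ {R} → pair (relSpan R) ≤ₘ Rel.arr R
  relSpan-pair-≤ₘ = id , Equiv.trans identityʳ (Equiv.sym ⟨⟩-η)

  arr-≤ₘ-relSpan-pair : ∀ {R} → Rel.arr R ≤ₘ pair (relSpan R)
  arr-≤ₘ-relSpan-pair = id , Equiv.trans identityʳ ⟨⟩-η

  ⇛-relSpan⇒≤ₘ : ∀ {s R} → s ⇛ relSpan R → pair s ≤ₘ Rel.arr R
  ⇛-relSpan⇒≤ₘ {R = R} f = ≤ₘ-trans (⇛⇒≤ₘ f) (relSpan-pair-≤ₘ {R})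

  ≤ₘ⇒⇛-relSpan : ∀ {s R} → pair s ≤ₘ Rel.arr R → s ⇛ relSpan R
  ≤ₘ⇒⇛-relSpan (k , arr∘k≈pair) = record
    { map = k
    ; src-map = Equiv.trans (pullʳ arr∘k≈pair) π₁∘⟨⟩
    ; tgt-map = Equiv.trans (pullʳ arr∘k≈pair) π₂∘⟨⟩
    }

  ≤R⇒⇛ : ∀ {R S} → R ≤R S → relSpan R ⇛ relSpan S
  ≤R⇒⇛ {R} {S} R≤S = ≤ₘ⇒⇛-relSpan {R = S} (≤ₘ-trans (relSpan-pair-≤ₘ {R}) R≤S)

  infixr 6 _⊙_
  _⊙_ : Span → Span → Span
  s ⊙ t = span (src s ∘ Pullback.p₁ pb) (tgt t ∘ Pullback.p₂ pb)
    where pb = pullback (tgt s) (src t)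

  module ⊙ (s t : Span) where
    open Pullback (pullback (tgt s) (src t)) public
    open IsPullback isPullback public

  ⊙-pair : ∀ {s t Z} {l r : Z ⇒ A} (x : Z ⇒ apex s) (y : Z ⇒ apex t) →
           tgt s ∘ x ≈ src t ∘ y → src s ∘ x ≈ l → tgt t ∘ y ≈ r → span l r ⇛ (s ⊙ t)
  ⊙-pair {s} {t} x y meet src-x tgt-y = record
    { map = proj₁ u
    ; src-map = Equiv.trans (pullʳ (proj₁ (proj₂ u))) src-x
    ; tgt-map = Equiv.trans (pullʳ (proj₂ (proj₂ u))) tgt-y
    }
    where u = ⊙.universal s t x y meet

  ⊙-map : ∀ {s s' t t'} → s ⇛ s' → t ⇛ t' → (s ⊙ t) ⇛ (s' ⊙ t')
  ⊙-map {s} {s'} {t} {t'} f g = ⊙-pair (map f ∘ ⊙.p₁ s t) (map g ∘ ⊙.p₂ s t) (begin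
      tgt s' ∘ (map f ∘ ⊙.p₁ s t)   ≈⟨ pullˡ (tgt-map f) ⟩
      tgt s ∘ ⊙.p₁ s t              ≈⟨ ⊙.commute s t ⟩
      src t ∘ ⊙.p₂ s t              ≈⟨ pullˡ (src-map g) ⟨
      src t' ∘ (map g ∘ ⊙.p₂ s t)   ∎)
    (pullˡ (src-map f)) (pullˡ (tgt-map g))

  ⊙-unitˡ : ∀ {t} → (idSpan ⊙ t) ⇛ t
  ⊙-unitˡ {t} = record
    { map = ⊙.p₂ idSpan t
    ; src-map = Equiv.sym (⊙.commute idSpan t)
    ; tgt-map = Equiv.refl
    }

  ⊙-unitʳ⁻¹ : ∀ {s} → s ⇛ (s ⊙ idSpan)
  ⊙-unitʳ⁻¹ {s} = ⊙-pair id (tgt s) (Equiv.trans identityʳ (Equiv.sym identityˡ)) identityʳ identityˡ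

  ⊙-assoc : ∀ {s t u} → ((s ⊙ t) ⊙ u) ⇛ (s ⊙ (t ⊙ u))
  ⊙-assoc {s} {t} {u} = ⊙-pair (⊙.p₁ s t ∘ q₁) (map inner) (begin
      tgt s ∘ (⊙.p₁ s t ∘ q₁)   ≈⟨ pullˡ (⊙.commute s t) ⟩
      (src t ∘ ⊙.p₂ s t) ∘ q₁   ≈⟨ assoc ⟩
      src t ∘ (⊙.p₂ s t ∘ q₁)   ≈⟨ src-map inner ⟨
      src (t ⊙ u) ∘ map inner   ∎)
    sym-assoc (tgt-map inner)
    where
      q₁ = ⊙.p₁ (s ⊙ t) u
      q₂ = ⊙.p₂ (s ⊙ t) u
      inner : span (src t ∘ (⊙.p₂ s t ∘ q₁)) (tgt u ∘ q₂) ⇛ (t ⊙ u)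
      inner = ⊙-pair (⊙.p₂ s t ∘ q₁) q₂ (Equiv.trans sym-assoc (⊙.commute (s ⊙ t) u))
                     Equiv.refl Equiv.refl

  idSpan⇛-⊙ˡ : ∀ {s t} → idSpan ⇛ s → t ⇛ (s ⊙ t)
  idSpan⇛-⊙ˡ {s} {t} δ = ⊙-pair (map δ ∘ src t) id
    (Equiv.trans (pullˡ (tgt-map δ)) (Equiv.trans identityˡ (Equiv.sym identityʳ)))
    (Equiv.trans (pullˡ (src-map δ)) identityˡ) identityʳ

  reflexive⇒idSpan⇛ : ∀ {R} → Reflexive R → idSpan ⇛ relSpan R
  reflexive⇒idSpan⇛ {R} = ≤ₘ⇒⇛-relSpan {R = R}

  transitive⇒⊙⇛ : ∀ {R} → Transitive R → (relSpan R ⊙ relSpan R) ⇛ relSpan R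
  transitive⇒⊙⇛ {R} R-trans = ≤ₘ⇒⇛-relSpan {R = R} (≤ₘ-trans (≤-image _) R-trans)

  ⊙≤ₘ⇒transitive : ∀ {R} → pair (relSpan R ⊙ relSpan R) ≤ₘ Rel.arr R → Transitive R
  ⊙≤ₘ⇒transitive {R} = image-least (Rel.arr-mono R)

module SpanAlgebras {o ℓ e} (C : Category o ℓ e) (St : Notions.Standing C) (F : Endofunctor C)
                    {A : Category.Obj C} (a : Category._⇒_ C (Endofunctor.F₀ F A) A) where
  open Category C
  open Relations C St
  open Endofunctor F
  open HomReasoning C
  open ProductsAndImages C St
  open Homomorphisms C F
  open Congruences C St F a
  open Spans C St A
  open Span

  SpanHom : Span → Set (ℓ ⊔ e)
  SpanHom s = Σ (F₀ (apex s) ⇒ apex s) λ x → IsHom a x (src s) × IsHom a x (tgt s)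

  SpanHom⇒HomStructure : ∀ {s} → SpanHom s → HomStructure a² (pair s)
  SpanHom⇒HomStructure (x , src-hom , tgt-hom) = x , IsHom-⟨⟩ src-hom tgt-hom

  idSpan-hom : SpanHom idSpan
  idSpan-hom = a , id-hom , id-hom
    where
      id-hom : IsHom a a id
      id-hom = Equiv.trans identityˡ (Equiv.sym (Equiv.trans (refl⟩∘⟨ F-identity) identityʳ))

  relSpan-hom : ∀ {R} → Congruence F a R → SpanHom (relSpan R)
  relSpan-hom {R} R-cong with congruence⇒HomStructure R R-cong
  ... | x , arr-hom = x , IsHom-∘ π₁-hom arr-hom , IsHom-∘ π₂-hom arr-hom

  ⊙-hom : ∀ {s t} → SpanHom s → SpanHom t → SpanHom (s ⊙ t)
  ⊙-hom {s} {t} (x , src-s , tgt-s) (y , src-t , tgt-t) =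
    proj₁ u , Equiv.trans (pullʳ (proj₁ (proj₂ u))) (IsHom-∘F₁ src-s (⊙.p₁ s t))
            , Equiv.trans (pullʳ (proj₂ (proj₂ u))) (IsHom-∘F₁ tgt-t (⊙.p₂ s t))
    where
      u = ⊙.universal s t (x ∘ F₁ (⊙.p₁ s t)) (y ∘ F₁ (⊙.p₂ s t)) (begin
        tgt s ∘ (x ∘ F₁ (⊙.p₁ s t))   ≈⟨ IsHom-∘F₁ tgt-s (⊙.p₁ s t) ⟩
        a ∘ F₁ (tgt s ∘ ⊙.p₁ s t)     ≈⟨ refl⟩∘⟨ F-resp-≈ (⊙.commute s t) ⟩
        a ∘ F₁ (src t ∘ ⊙.p₂ s t)     ≈⟨ IsHom-∘F₁ src-t (⊙.p₂ s t) ⟨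
        src t ∘ (y ∘ F₁ (⊙.p₂ s t))   ∎)

module Paths {o ℓ e} (C : Category o ℓ e) (St : Notions.Standing C)
             {A : Category.Obj C} {I : Set ℓ} (ℛ : I → Relations.Rel C St A) where
  open Category C
  open Relations C St
  open Spans C St A

  -- R_{i₁} · … · R_{iₙ} computed by pullbacks alone, without taking images
  path : List I → Span
  path []      = idSpan
  path (i ∷ w) = relSpan (ℛ i) ⊙ path w

  path-++ : ∀ w w' → (path w ⊙ path w') ⇛ path (w ++ w')
  path-++ []      w' = ⊙-unitˡ
  path-++ (i ∷ w) w' = ⇛-trans ⊙-assoc (⊙-map ⇛-id (path-++ w w'))

  -- a letter of k missing from w is filled in by a reflexive step
  path-⊆ : (∀ i → Reflexive (ℛ i)) → ∀ {w k} → w ⊆ k → path w ⇛ path k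
  path-⊆ ℛ-refl []           = ⇛-id
  path-⊆ ℛ-refl (y ∷ʳ w⊆k)   =
    ⇛-trans (path-⊆ ℛ-refl w⊆k) (idSpan⇛-⊙ˡ (reflexive⇒idSpan⇛ {ℛ y} (ℛ-refl y)))
  path-⊆ ℛ-refl (refl ∷ w⊆k) = ⊙-map ⇛-id (path-⊆ ℛ-refl w⊆k)

  path⇛ : ∀ V → Reflexive V → Transitive V → (∀ i → ℛ i ≤R V) → ∀ w → path w ⇛ relSpan V
  path⇛ V V-refl V-trans ℛ≤V []      = reflexive⇒idSpan⇛ {V} V-refl
  path⇛ V V-refl V-trans ℛ≤V (i ∷ w) =
    ⇛-trans (⊙-map (≤R⇒⇛ {ℛ i} {V} (ℛ≤V i)) (path⇛ V V-refl V-trans ℛ≤V w))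
            (transitive⇒⊙⇛ {V} V-trans)

module DirectedSubobjects {o ℓ e} (C : Category o ℓ e) {X : Category.Obj C}
  {I : Set ℓ} (_≼_ : I → I → Set ℓ)
  (≼-refl : ∀ {i} → i ≼ i) (≼-trans : ∀ {i j k} → i ≼ j → j ≼ k → i ≼ k)
  (i₀ : I) (upper : ∀ i j → Σ I λ k → (i ≼ k) × (j ≼ k))
  (D : I → Category.Obj C) (m : ∀ i → Category._⇒_ C (D i) X)
  (m-mono : ∀ i → Notions.Mono C (m i))
  (≼⇒≤ₘ : ∀ {i j} → i ≼ j → Notions._≤ₘ_ C (m i) (m j)) where
  open Category C
  open Notions C
  open HomReasoning C

  inclusion : ∀ {i j} → i ≼ j → D i ⇒ D j
  inclusion p = proj₁ (≼⇒≤ₘ p)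

  inclusion-unique : ∀ {i j} {p : i ≼ j} {t : D i ⇒ D j} → m j ∘ t ≈ m i → inclusion p ≈ t
  inclusion-unique {j = j} {p} mt≈m = m-mono j _ _ (Equiv.trans (proj₂ (≼⇒≤ₘ p)) (Equiv.sym mt≈m))

  diagram : DirectedDiagram
  diagram = record
    { I = I ; _≤_ = _≼_ ; ≤-refl = ≼-refl ; ≤-trans = ≼-trans
    ; inhabited = i₀ ; upper = upper ; D = D ; d = inclusion
    ; d-irrelevant = λ p q → inclusion-unique (proj₂ (≼⇒≤ₘ q))
    ; d-identity = inclusion-unique identityʳ
    ; d-homomorphism = λ p q → inclusion-unique
        (Equiv.trans (pullˡ (proj₂ (≼⇒≤ₘ q))) (proj₂ (≼⇒≤ₘ p)))
    }

  -- SmoothMonos yields the colimit of the diagram of all maps over X between the D i;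
  -- by directedness and monicity it has the same cocones as the diagram of inclusions.
  smooth-colimit : SmoothMonos →
    ∀ {L} (j : L ⇒ X) → Mono j → (u : ∀ i → D i ⇒ L) → (∀ i → j ∘ u i ≈ m i) →
    (∀ {Z} (z : Z ⇒ X) → Mono z → (∀ i → m i ≤ₘ z) → j ≤ₘ z) →
    IsColimit D _≼_ inclusion L u
  smooth-colimit smooth j j-mono u ju≈m j-least = record
    { cocone = λ p → IsColimit.cocone colim (≼⇒≤ₘ p)
    ; universal = λ z z-cocone → IsColimit.universal colim z (all-maps-cocone z z-cocone)
    ; unique = IsColimit.unique colim
    }
    where
      colim = smooth D m m-mono i₀
        (λ i k → let (l , i≼l , k≼l) = upper i k in l , ≼⇒≤ₘ i≼l , ≼⇒≤ₘ k≼l)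
        j j-mono u ju≈m j-least

      all-maps-cocone : ∀ {Z} (z : ∀ i → D i ⇒ Z) → (∀ {i k} (p : i ≼ k) → z k ∘ inclusion p ≈ z i) →
                        ∀ {i k} (t : Σ (D i ⇒ D k) λ t → m k ∘ t ≈ m i) → z k ∘ proj₁ t ≈ z i
      all-maps-cocone z z-cocone {i} {k} (t , mt≈m) with upper i k
      ... | l , i≼l , k≼l = begin
        z k ∘ t                      ≈⟨ z-cocone k≼l ⟩∘⟨refl ⟨
        (z l ∘ inclusion k≼l) ∘ t    ≈⟨ pullʳ (Equiv.sym (inclusion-unique {p = i≼l} m-through-k)) ⟩
        z l ∘ inclusion i≼l          ≈⟨ z-cocone i≼l ⟩
        z i                          ∎
        where
          m-through-k : m l ∘ (inclusion k≼l ∘ t) ≈ m i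
          m-through-k = Equiv.trans (pullˡ (proj₂ (≼⇒≤ₘ k≼l))) mt≈m

module ExtensiveCovers {o ℓ e} (C : Category o ℓ e) (St : Notions.Standing C)
                       (Ext : Notions.InfinitaryExtensive C) where
  open Category C
  open Notions C
  open Notions.Standing St
  open Notions.InfinitaryExtensive Ext
  open HomReasoning C
  open Factoring C

  -- Pull the cover ε back along g (still a strong epi) and split the pullback
  -- into pieces over the X j by extensivity; h is then assembled from its pieces.
  ≤ₘ-from-cover : ∀ {J : Set ℓ} {X : J → Obj} {E Y B M'}
    {ε : IndexedCoproduct.∐X (coproduct J X) ⇒ E} {g : Y ⇒ E} {h : Y ⇒ B} {M : M' ⇒ B} →
    StrongEpi ε → Mono M →
    (∀ j {Z} (t : Z ⇒ X j) (s : Z ⇒ Y) →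
       ε ∘ (IndexedCoproduct.ι (coproduct J X) j ∘ t) ≈ g ∘ s → (h ∘ s) ≤ₘ M) →
    h ≤ₘ M
  ≤ₘ-from-cover {J} {X} {Y = Y} {ε = ε} {g} ε-strongEpi M-mono on-pieces
    with essSurj (Pullback.p₂ (pullback g ε))
  ... | Y' , p , φ , φ-iso , p₂φ≈∐p =
    strongEpi-cancel (strongEpi-pullback (Pullback.isPullback pb) ε-strongEpi) M-mono
      (iso-cancel φ-iso (≤ₘ-copair (coproduct J Y') λ j →
        ≤ₘ-resp-≈ (Equiv.trans sym-assoc sym-assoc) (on-pieces j (p j) (piece j) (piece-covered j))))
    where
      pb = pullback g ε
      open Pullback pb using (p₁; p₂)
      module X = IndexedCoproduct (coproduct J X)
      module Y' = IndexedCoproduct (coproduct J Y')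

      piece : ∀ j → Y' j ⇒ Y
      piece j = p₁ ∘ (φ ∘ Y'.ι j)

      piece-covered : ∀ j → ε ∘ (X.ι j ∘ p j) ≈ g ∘ piece j
      piece-covered j = begin
        ε ∘ (X.ι j ∘ p j)           ≈⟨ refl⟩∘⟨ Y'.inject _ j ⟨
        ε ∘ (∐ p ∘ Y'.ι j)          ≈⟨ refl⟩∘⟨ pullˡ p₂φ≈∐p ⟨
        ε ∘ (p₂ ∘ (φ ∘ Y'.ι j))     ≈⟨ sym-assoc ⟩
        (ε ∘ p₂) ∘ (φ ∘ Y'.ι j)     ≈⟨ pullˡ (IsPullback.commute (Pullback.isPullback pb)) ⟨
        g ∘ piece j                 ∎

module PathUnion {o ℓ e} (C : Category o ℓ e) (St : Notions.Standing C)
                 (Ext : Notions.InfinitaryExtensive C)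
                 {A : Category.Obj C} {I : Set ℓ} (ℛ : I → Relations.Rel C St A) where
  open Category C
  open Notions C
  open Notions.Standing St
  open Notions.InfinitaryExtensive Ext using (coproduct)
  open Relations C St
  open HomReasoning C
  open Factoring C
  open ProductsAndImages C St
  open Spans C St A
  open Span
  open Paths C St ℛ
  open ExtensiveCovers C St Ext

  private
    module ∐path = IndexedCoproduct (coproduct (List I) (λ w → apex (path w)))

    τ : ∐path.∐X ⇒ A ×₀ A
    τ = ∐path.copair (λ w → pair (path w))

  W : Rel A
  W = imageRel τ

  private
    ε : ∐path.∐X ⇒ Rel.carrier W
    ε = image-cover τ

    W-mono : Mono (Rel.arr W)
    W-mono = Rel.arr-mono W

  on-cover : ∀ w {Z} (t : Z ⇒ apex (path w)) → Rel.arr W ∘ (ε ∘ (∐path.ι w ∘ t)) ≈ pair (path w) ∘ t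
  on-cover w t = begin
    Rel.arr W ∘ (ε ∘ (∐path.ι w ∘ t))   ≈⟨ pullˡ (image-factors τ) ⟩
    τ ∘ (∐path.ι w ∘ t)                 ≈⟨ pullˡ (∐path.inject _ w) ⟩
    pair (path w) ∘ t                   ∎

  src-on-cover : ∀ w {Z} (t : Z ⇒ apex (path w)) → Rel.l W ∘ (ε ∘ (∐path.ι w ∘ t)) ≈ src (path w) ∘ t
  src-on-cover w t = Equiv.trans (pullʳ (on-cover w t)) (pullˡ π₁∘⟨⟩)

  tgt-on-cover : ∀ w {Z} (t : Z ⇒ apex (path w)) → Rel.r W ∘ (ε ∘ (∐path.ι w ∘ t)) ≈ tgt (path w) ∘ t
  tgt-on-cover w t = Equiv.trans (pullʳ (on-cover w t)) (pullˡ π₂∘⟨⟩)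

  path≤W : ∀ w → pair (path w) ≤ₘ Rel.arr W
  path≤W w = ≤ₘ-resp-≈ identityʳ (_ , on-cover w id)

  W-least : ∀ {Y} {M : Y ⇒ A ×₀ A} → Mono M → (∀ w → pair (path w) ≤ₘ M) → Rel.arr W ≤ₘ M
  W-least M-mono paths≤M = image-least M-mono
    (≤ₘ-copair (coproduct (List I) _) λ w → ≤ₘ-resp-≈ (Equiv.sym (∐path.inject _ w)) (paths≤M w))

  W-reflexive : Reflexive W
  W-reflexive = path≤W []

  ℛ≤W : ∀ i → ℛ i ≤R W
  ℛ≤W i = ≤ₘ-trans (arr-≤ₘ-relSpan-pair {ℛ i}) (≤ₘ-trans (⇛⇒≤ₘ ⊙-unitʳ⁻¹) (path≤W (i ∷ [])))

  private
    WW : Span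
    WW = relSpan W ⊙ relSpan W

    module WW = ⊙ (relSpan W) (relSpan W)

  -- two paths meeting in W compose to the path of the concatenated word
  composable-paths≤W : ∀ w w' {Z} (t : Z ⇒ apex (path w)) (t' : Z ⇒ apex (path w')) (u : Z ⇒ apex WW) →
    ε ∘ (∐path.ι w ∘ t) ≈ WW.p₁ ∘ u → ε ∘ (∐path.ι w' ∘ t') ≈ WW.p₂ ∘ u → (pair WW ∘ u) ≤ₘ Rel.arr W
  composable-paths≤W w w' t t' u t≈p₁u t'≈p₂u =
    ≤ₘ-resp-≈ pair-joined (≤ₘ-trans (⇛⇒≤ₘ joined) (path≤W (w ++ w')))
    where
      meet : tgt (path w) ∘ t ≈ src (path w') ∘ t'
      meet = begin
        tgt (path w) ∘ t                     ≈⟨ tgt-on-cover w t ⟨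
        Rel.r W ∘ (ε ∘ (∐path.ι w ∘ t))      ≈⟨ refl⟩∘⟨ t≈p₁u ⟩
        Rel.r W ∘ (WW.p₁ ∘ u)                ≈⟨ pullˡ WW.commute ⟩
        (Rel.l W ∘ WW.p₂) ∘ u                ≈⟨ assoc ⟩
        Rel.l W ∘ (WW.p₂ ∘ u)                ≈⟨ refl⟩∘⟨ t'≈p₂u ⟨
        Rel.l W ∘ (ε ∘ (∐path.ι w' ∘ t'))    ≈⟨ src-on-cover w' t' ⟩
        src (path w') ∘ t'                   ∎

      joined : span (Rel.l W ∘ (WW.p₁ ∘ u)) (Rel.r W ∘ (WW.p₂ ∘ u)) ⇛ path (w ++ w')
      joined = ⇛-trans
        (⊙-pair t t' meet
          (Equiv.trans (Equiv.sym (src-on-cover w t)) (refl⟩∘⟨ t≈p₁u))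
          (Equiv.trans (Equiv.sym (tgt-on-cover w' t')) (refl⟩∘⟨ t'≈p₂u)))
        (path-++ w w')

      pair-joined : ⟨ Rel.l W ∘ (WW.p₁ ∘ u) , Rel.r W ∘ (WW.p₂ ∘ u) ⟩ ≈ pair WW ∘ u
      pair-joined = Equiv.sym (Equiv.trans ⟨⟩∘ (⟨⟩-cong assoc assoc))

  W-transitive : Transitive W
  W-transitive = ⊙≤ₘ⇒transitive {W}
    (≤ₘ-from-cover (image-cover-strongEpi τ) W-mono λ w t u t≈p₁u →
      ≤ₘ-from-cover (image-cover-strongEpi τ) W-mono λ w' t' s t'≈p₂us →
        ≤ₘ-resp-≈ sym-assoc (composable-paths≤W w w' (t ∘ s) t' (u ∘ s)
                                                  (restrict t≈p₁u) (Equiv.trans t'≈p₂us assoc)))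
    where
      restrict : ∀ {w Z Z'} {t : Z ⇒ apex (path w)} {u : Z ⇒ apex WW} {s : Z' ⇒ Z} →
                 ε ∘ (∐path.ι w ∘ t) ≈ WW.p₁ ∘ u → ε ∘ (∐path.ι w ∘ (t ∘ s)) ≈ WW.p₁ ∘ (u ∘ s)
      restrict {w} {t = t} {u} {s} t≈p₁u = begin
        ε ∘ (∐path.ι w ∘ (t ∘ s))   ≈⟨ refl⟩∘⟨ sym-assoc ⟩
        ε ∘ ((∐path.ι w ∘ t) ∘ s)   ≈⟨ sym-assoc ⟩
        (ε ∘ (∐path.ι w ∘ t)) ∘ s   ≈⟨ t≈p₁u ⟩∘⟨refl ⟩
        (WW.p₁ ∘ u) ∘ s             ≈⟨ assoc ⟩
        WW.p₁ ∘ (u ∘ s)             ∎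

  module _ (smooth : SmoothMonos) (F : Endofunctor C) (F-strongEpi : PreservesStrongEpi F)
           (F-colimits : PreservesDirectedColimits F) (a : Endofunctor.F₀ F A ⇒ A)
           (ℛ-refl : ∀ i → Reflexive (ℛ i)) (ℛ-cong : ∀ i → Congruence F a (ℛ i)) where
    open Homomorphisms C F
    open Congruences C St F a
    open SpanAlgebras C St F a

    path-hom : ∀ w → SpanHom (path w)
    path-hom []      = idSpan-hom
    path-hom (i ∷ w) = ⊙-hom (relSpan-hom {ℛ i} (ℛ-cong i)) (path-hom w)

    private
      S : List I → Obj
      S w = ImObj (pair (path w))

      m : ∀ w → S w ⇒ A ×₀ A
      m w = Image (pair (path w))

      m-hom : ∀ w → HomStructure a² (m w)
      m-hom w = HomStructure-descends F-strongEpi (image-cover-strongEpi _) (image-mono _)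
        (HomStructure-resp-≈ (Equiv.sym (image-factors _)) (SpanHom⇒HomStructure (path-hom w)))

      m≤W : ∀ w → m w ≤ₘ Rel.arr W
      m≤W w = image-least W-mono (path≤W w)

      upper : ∀ w k → Σ (List I) λ l → (w ⊆ l) × (k ⊆ l)
      upper w k = w ++ k , ++⁺ʳ k ⊆-refl , ++⁺ˡ w ⊆-refl

    open DirectedSubobjects C _⊆_ ⊆-refl ⊆-trans [] upper S m (λ w → image-mono _)
      (λ w⊆k → image-least (image-mono _) (≤ₘ-trans (⇛⇒≤ₘ (path-⊆ ℛ-refl w⊆k)) (≤-image _)))

    W-congruence : Congruence F a W
    W-congruence = HomStructure⇒congruence W
      (HomStructure-colimit F-colimits diagram W-colimit W-mono λ w →
        HomStructure-resp-≈ (Equiv.sym (proj₂ (m≤W w))) (m-hom w))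
      where
        W-colimit : IsColimit S _⊆_ inclusion (Rel.carrier W) (λ w → proj₁ (m≤W w))
        W-colimit = smooth-colimit smooth (Rel.arr W) W-mono (λ w → proj₁ (m≤W w)) (λ w → proj₂ (m≤W w))
          λ z z-mono m≤z → W-least z-mono (λ w → ≤ₘ-trans (≤-image _) (m≤z w))

lemma4p17 : ∀ {o ℓ e : Level} (C : Category o ℓ e) (St : Notions.Standing C) →
    Notions.InfinitaryExtensive C → Notions.SmoothMonos C →
    (Σ : Endofunctor C) →
    Notions.PreservesStrongEpi C Σ → Notions.PreservesMono C Σ →
    Notions.PreservesDirectedColimits C Σ →
    ∀ {A : Category.Obj C} (a : Category._⇒_ C (Endofunctor.F₀ Σ A) A)
      {I : Set ℓ} (ℛ : I → Relations.Rel C St A) →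
    (∀ i → Relations.Reflexive C St (ℛ i)) →
    (∀ i → Relations.Congruence C St Σ a (ℛ i)) →
    ∀ (J : Relations.Rel C St A) → Relations.IsJoin C St ℛ J →
    ∀ (U : Relations.Rel C St A) → Relations.IsRTClosure C St J U →
    Relations.Congruence C St Σ a U
lemma4p17 C St Ext smooth Σ Σ-strongEpi _ Σ-colimits a ℛ ℛ-refl ℛ-cong
          J (ℛ≤J , J-least) U (U-refl , U-trans , J≤U , U-least) =
  congruence-transfer {W} {U} (W-congruence smooth Σ Σ-strongEpi Σ-colimits a ℛ-refl ℛ-cong) W≤U U≤W
  where
    open Relations C St using (_≤R_)
    open Factoring C
    open Congruences C St Σ a
    open Spans C St _
    open Paths C St ℛ
    open PathUnion C St Ext ℛ

    U≤W : U ≤R W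
    U≤W = U-least W W-reflexive W-transitive (J-least W ℛ≤W)
    W≤U : W ≤R U
    W≤U = W-least (Relations.Rel.arr-mono U)
      (λ w → ⇛-relSpan⇒≤ₘ {R = U} (path⇛ U U-refl U-trans (λ i → ≤ₘ-trans (ℛ≤J i) J≤U) w))
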